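{- Let $\alpha$ be a simple loop with $\mathrm{update}(\alpha)=\mu$ and $\mathrm{guard}(\alpha) = \varphi\land\psi$ such that $\mathrm{guard}(\alpha)\implies\psi\mu$ is valid. Let $b$ be an arithmetic expression such that the formulas \[ \neg\varphi\land\psi \implies b\leq 0 \qquad\text{and}\qquad \varphi\land\psi\implies b\mu\geq b-1 \] are valid. Then $\chi_\psi\cdot b$ is a metering function for $\alpha$.
   Context: Variables range over $\mathbb{Z}$. Arithmetic expressions are built from variables, numbers and operations such as $+,-,\cdot$, division and exponentiation; a constraint is a finite conjunction of inequations ($<,\leq,>,\geq$) between arithmetic expressions. A rule has the form $f(\vec x)\xrightarrow{c}T\ [\varphi]$ with a fixed vector $\vec x$ of pairwise different program variables, a function symbol $f$, a cost expression $c$, a finite multiset $T$ of terms $g(t_1,\dots,t_k)$ (with arithmetic expressions $t_i$) and a guard constraint $\varphi=\mathrm{guard}$. A substitution maps variables to arithmetic expressions and is applied homomorphically ($t\sigma$). A simple loop is a rule $\alpha$ of the form $f(\vec x)\xrightarrow{c}f(\vec x)\mu\ [\varphi]$, where $\mu$ is a substitution with $\mathrm{dom}(\mu)\subseteq\vec x$, called $\mathrm{update}(\alpha)$. An integer substitution maps variables in its domain to integers; $\sigma\models\varphi$ means all variables of $\varphi$ are in $\mathrm{dom}(\sigma)$ and $\sigma$ is a model of $\varphi$. A quantifier-free formula is valid if every integer substitution whose domain contains its variables is a model of it. For a constraint $\psi$, the characteristic function $\chi_\psi$ satisfies, for every integer substitution $\sigma$ whose domain contains the variables of $\psi$, $\chi_\psi\sigma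 = 1$ if $\sigma\models\psi$ and $\chi_\psi\sigma = 0$ otherwise. An arithmetic expression $b$ (possibly involving characteristic functions) is a metering function for a simple loop $\alpha$ with update $\mu$ if $\neg\mathrm{guard}(\alpha)\implies b\leq 0$ and $\mathrm{guard}(\alpha)\implies b\mu\geq b-1$ are valid. -}

module Defs where

open import Data.Nat as ℕ using (ℕ)
open import Data.Integer as ℤ using (ℤ; +_; -[1+_]; +0; +[1+_])
open import Data.Bool using (Bool; true; false; _∧_; not; if_then_else_)
open import Data.List using (List; []; _∷_; _++_)
open import Data.List.Relation.Unary.All using (All)
open import Data.List.Relation.Unary.Unique.Propositional using (Unique)
open import Data.List.Membership.Propositional using (_∉_)
open import Data.Product using (_×_)
open import Relation.Nullary using (¬_)
open import Relation.Binary.PropositionalEquality using (_≡_)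

Var : Set
Var = ℕ

data Rel : Set where
  lt le gt ge : Rel

mutual
  data Expr : Set where
    var  : Var → Expr
    num  : ℤ → Expr
    _⊕_  : Expr → Expr → Expr
    _⊖_  : Expr → Expr → Expr
    _⊗_  : Expr → Expr → Expr
    _⊘_  : Expr → Expr → Expr
    _⊛_  : Expr → Expr → Expr
    χ    : Constraint → Expr

  data Atom : Set where
    ineq : Expr → Rel → Expr → Atom

  Constraint : Set
  Constraint = List Atom

-- Integer substitutions (total valuations; only the variables occurring
-- in an expression matter).
Valuation : Set
Valuation = Var → ℤ

-- Conventions for the partial operations: x / 0 = 0 (otherwise the
-- stdlib integer division), x ^ y = 0 for y < 0.
divℤ : ℤ → ℤ → ℤ
divℤ x +0 = +0
divℤ x y@(+[1+ n ]) = x ℤ./ y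
divℤ x y@(-[1+ n ]) = x ℤ./ y

powℤ : ℤ → ℤ → ℤ
powℤ x (+ n) = x ℤ.^ n
powℤ x -[1+ n ] = +0

relᵇ : Rel → ℤ → ℤ → Bool
relᵇ lt x y = not (y ℤ.≤ᵇ x)
relᵇ le x y = x ℤ.≤ᵇ y
relᵇ gt x y = not (x ℤ.≤ᵇ y)
relᵇ ge x y = y ℤ.≤ᵇ x

mutual
  ⟦_⟧ : Expr → Valuation → ℤ
  ⟦ var v ⟧ σ = σ v
  ⟦ num n ⟧ σ = n
  ⟦ a ⊕ b ⟧ σ = ⟦ a ⟧ σ ℤ.+ ⟦ b ⟧ σ
  ⟦ a ⊖ b ⟧ σ = ⟦ a ⟧ σ ℤ.- ⟦ b ⟧ σ
  ⟦ a ⊗ b ⟧ σ = ⟦ a ⟧ σ ℤ.* ⟦ b ⟧ σ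
  ⟦ a ⊘ b ⟧ σ = divℤ (⟦ a ⟧ σ) (⟦ b ⟧ σ)
  ⟦ a ⊛ b ⟧ σ = powℤ (⟦ a ⟧ σ) (⟦ b ⟧ σ)
  ⟦ χ ψ ⟧ σ = if holdsᵇ ψ σ then ℤ.1ℤ else ℤ.0ℤ

  holdsᵇ : Constraint → Valuation → Bool
  holdsᵇ [] σ = true
  holdsᵇ (ineq a r b ∷ ψ) σ = relᵇ r (⟦ a ⟧ σ) (⟦ b ⟧ σ) ∧ holdsᵇ ψ σ

relSem : Rel → ℤ → ℤ → Set
relSem lt x y = x ℤ.< y
relSem le x y = x ℤ.≤ y
relSem gt x y = x ℤ.> y
relSem ge x y = x ℤ.≥ y

_⊨ₐ_ : Valuation → Atom → Set
σ ⊨ₐ ineq a r b = relSem r (⟦ a ⟧ σ) (⟦ b ⟧ σ)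

_⊨_ : Valuation → Constraint → Set
σ ⊨ φ = All (σ ⊨ₐ_) φ

-- Substitutions (variables outside the domain are mapped to themselves),
-- applied homomorphically.
Subst : Set
Subst = Var → Expr

mutual
  _[_] : Expr → Subst → Expr
  var v [ μ ] = μ v
  num n [ μ ] = num n
  (a ⊕ b) [ μ ] = (a [ μ ]) ⊕ (b [ μ ])
  (a ⊖ b) [ μ ] = (a [ μ ]) ⊖ (b [ μ ])
  (a ⊗ b) [ μ ] = (a [ μ ]) ⊗ (b [ μ ])
  (a ⊘ b) [ μ ] = (a [ μ ]) ⊘ (b [ μ ])
  (a ⊛ b) [ μ ] = (a [ μ ]) ⊛ (b [ μ ])
  χ ψ [ μ ] = χ (ψ [ μ ]ᶜ)

  _[_]ᶜ : Constraint → Subst → Constraint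
  [] [ μ ]ᶜ = []
  (ineq a r b ∷ ψ) [ μ ]ᶜ = ineq (a [ μ ]) r (b [ μ ]) ∷ (ψ [ μ ]ᶜ)

-- A simple loop  f(x⃗) --c--> f(x⃗)μ [φ]  with pairwise different program
-- variables x⃗ and dom(μ) ⊆ x⃗.
record SimpleLoop : Set where
  field
    vars      : List Var
    distinct  : Unique vars
    cost      : Expr
    guard     : Constraint
    update    : Subst
    updateDom : ∀ v → v ∉ vars → update v ≡ var v

open SimpleLoop public

IsMeteringFunction : SimpleLoop → Expr → Set
IsMeteringFunction α b =
  (∀ (σ : Valuation) → ¬ (σ ⊨ guard α) → ⟦ b ⟧ σ ℤ.≤ ℤ.0ℤ) ×
  (∀ (σ : Valuation) → σ ⊨ guard α →
     ⟦ b [ update α ] ⟧ σ ℤ.≥ ⟦ b ⟧ σ ℤ.- ℤ.1ℤ)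

module Submission where

-- The expression χ_ψ · b is evaluated by cases on σ ⊨ ψ:
-- it equals b where ψ holds and 0 where ψ fails.
--   * ¬guard ⇒ χ_ψ·b ≤ 0: if ψ fails the value is 0; if ψ holds then φ
--     must fail (otherwise the guard φ ∧ ψ would hold), so the value is
--     b ≤ 0 by the first hypothesis.
--   * guard ⇒ (χ_ψ·b)μ ≥ χ_ψ·b − 1: substitution commutes with χ, so
--     (χ_ψ·b)μ = χ_{ψμ}·bμ.  Under the guard both ψ and (by invariance)
--     ψμ hold, so both characteristic functions are 1 and the claim is
--     the second hypothesis bμ ≥ b − 1.
-- The file first relates the boolean evaluation holdsᵇ used by χ to the
-- propositional satisfaction ⊨ (soundness and completeness), derives the
-- two evaluation rules for χ_ψ · b, and then proves the theorem.

open import Defs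
open import Data.Integer using (_≤_; _≥_; _-_; 0ℤ; 1ℤ)
import Data.Integer.Properties as ℤP
open import Data.Bool using (true; false; T; not)
open import Data.Bool.Properties using (T-∧)
open import Data.Unit using (tt)
open import Data.Empty using (⊥-elim)
open import Data.Product using (_,_)
open import Data.List using (_++_; []; _∷_)
open import Data.List.Relation.Unary.All using ([]; _∷_)
open import Data.List.Relation.Unary.All.Properties using (++⁺; ++⁻ʳ)
open import Function using (_∘_)
open import Function.Bundles using (Equivalence)
open import Relation.Nullary using (¬_; Dec; yes; no)
open import Relation.Binary.PropositionalEquality
  using (_≡_; refl; sym; subst; subst₂)

T-not⇒¬T : ∀ {c} → T (not c) → ¬ T c
T-not⇒¬T {false} _ ()

¬T⇒T-not : ∀ {c} → ¬ T c → T (not c)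
¬T⇒T-not {false} _ = tt
¬T⇒T-not {true}  f = f tt

relᵇ-sound : ∀ r x y → T (relᵇ r x y) → relSem r x y
relᵇ-sound lt x y t = ℤP.≰⇒> (T-not⇒¬T t ∘ ℤP.≤⇒≤ᵇ)
relᵇ-sound le x y t = ℤP.≤ᵇ⇒≤ t
relᵇ-sound gt x y t = relᵇ-sound lt y x t
relᵇ-sound ge x y t = ℤP.≤ᵇ⇒≤ t

relᵇ-complete : ∀ r x y → relSem r x y → T (relᵇ r x y)
relᵇ-complete lt x y p = ¬T⇒T-not (ℤP.<⇒≱ p ∘ ℤP.≤ᵇ⇒≤)
relᵇ-complete le x y p = ℤP.≤⇒≤ᵇ p
relᵇ-complete gt x y p = relᵇ-complete lt y x p
relᵇ-complete ge x y p = ℤP.≤⇒≤ᵇ p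

holdsᵇ-sound : ∀ ψ σ → T (holdsᵇ ψ σ) → σ ⊨ ψ
holdsᵇ-sound []               σ t = []
holdsᵇ-sound (ineq a r b ∷ ψ) σ t with Equivalence.to T-∧ t
... | tr , tψ = relᵇ-sound r _ _ tr ∷ holdsᵇ-sound ψ σ tψ

holdsᵇ-complete : ∀ ψ σ → σ ⊨ ψ → T (holdsᵇ ψ σ)
holdsᵇ-complete []               σ []       = tt
holdsᵇ-complete (ineq a r b ∷ ψ) σ (p ∷ ps) =
  Equivalence.from T-∧ (relᵇ-complete r _ _ p , holdsᵇ-complete ψ σ ps)

_⊨?_ : ∀ σ ψ → Dec (σ ⊨ ψ)
σ ⊨? ψ with holdsᵇ ψ σ in e
... | true  = yes (holdsᵇ-sound ψ σ (subst T (sym e) tt))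
... | false = no (λ sψ → subst T e (holdsᵇ-complete ψ σ sψ))

⟦χ⊗⟧-sat : ∀ ψ b σ → σ ⊨ ψ → ⟦ χ ψ ⊗ b ⟧ σ ≡ ⟦ b ⟧ σ
⟦χ⊗⟧-sat ψ b σ sψ with holdsᵇ ψ σ | holdsᵇ-complete ψ σ sψ
... | true | _ = ℤP.*-identityˡ (⟦ b ⟧ σ)

⟦χ⊗⟧-unsat : ∀ ψ b σ → ¬ (σ ⊨ ψ) → ⟦ χ ψ ⊗ b ⟧ σ ≡ 0ℤ
⟦χ⊗⟧-unsat ψ b σ ¬sψ with holdsᵇ ψ σ in e
... | false = refl
... | true  = ⊥-elim (¬sψ (holdsᵇ-sound ψ σ (subst T (sym e) tt)))

theorem3p4 : (α : SimpleLoop) (φ ψ : Constraint) →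
    guard α ≡ φ ++ ψ →
    (∀ (σ : Valuation) → σ ⊨ guard α → σ ⊨ (ψ [ update α ]ᶜ)) →
    (b : Expr) →
    (∀ (σ : Valuation) → ¬ (σ ⊨ φ) → σ ⊨ ψ → ⟦ b ⟧ σ ≤ 0ℤ) →
    (∀ (σ : Valuation) → σ ⊨ (φ ++ ψ) → ⟦ b [ update α ] ⟧ σ ≥ ⟦ b ⟧ σ - 1ℤ) →
    IsMeteringFunction α (χ ψ ⊗ b)
theorem3p4 α φ ψ guard≡φψ ψ-invariant b b≤0 b-decrease =
  nonpositive-outside , decreases-by-at-most-one
  where
  μ : Subst
  μ = update α

  splitGuard : ∀ σ → σ ⊨ guard α → σ ⊨ (φ ++ ψ)
  splitGuard σ = subst (σ ⊨_) guard≡φψ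

  -- Outside the guard: 0 if ψ fails; otherwise φ fails and b ≤ 0 applies.
  nonpositive-outside : ∀ σ → ¬ (σ ⊨ guard α) → ⟦ χ ψ ⊗ b ⟧ σ ≤ 0ℤ
  nonpositive-outside σ ¬guard with σ ⊨? ψ
  ... | no ¬sψ = ℤP.≤-reflexive (⟦χ⊗⟧-unsat ψ b σ ¬sψ)
  ... | yes sψ = subst (_≤ 0ℤ) (sym (⟦χ⊗⟧-sat ψ b σ sψ))
                   (b≤0 σ (λ sφ → ¬guard (subst (σ ⊨_) (sym guard≡φψ) (++⁺ sφ sψ))) sψ)

  decreases-by-at-most-one : ∀ σ → σ ⊨ guard α →
    ⟦ (χ ψ ⊗ b) [ μ ] ⟧ σ ≥ ⟦ χ ψ ⊗ b ⟧ σ - 1ℤ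
  decreases-by-at-most-one σ g =
    subst₂ (λ x y → x ≥ y - 1ℤ)
      (sym (⟦χ⊗⟧-sat (ψ [ μ ]ᶜ) (b [ μ ]) σ (ψ-invariant σ g)))
      (sym (⟦χ⊗⟧-sat ψ b σ (++⁻ʳ φ (splitGuard σ g))))
      (b-decrease σ (splitGuard σ g))
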